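{- Let $A=\{a_s(n_s)\}_{s=1}^k$ (with $a_s\in\mathbb Z$, $n_s\in\mathbb Z^+$) be an $m$-cover of $\mathbb Z$. Let $m_1,\ldots,m_k\in\mathbb Z$ and let $\mu_1,\ldots,\mu_k\in\mathbb Q$ be such that $\sum_{s\in I}\mu_s\in\mathbb Z$ for every $I\subseteq\{1,\ldots,k\}$ with $\sum_{s\in I}m_s/n_s\in\mathbb Z$. Let $p$ be a prime such that there is no nonempty $I\subseteq\{1,\ldots,k\}$ with both $\sum_{s\in I}m_s/n_s\in\mathbb Z$ and $\sum_{s\in I}\mu_s\in p\mathbb Z$. Then $$\Big|\Big\{\sum_{s\in I}\mu_s\bmod p:\ \emptyset\ne I\subseteq\{1,\ldots,k\}\ \text{and}\ \sum_{s\in I}\frac{m_s}{n_s}\in\mathbb Z\Big\}\Big|\ge m.$$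
   Context: For $a\in\mathbb Z$ and $n\in\mathbb Z^+$, $a(n)=a+n\mathbb Z$. For $A=\{a_s(n_s)\}_{s=1}^k$, $w_A(x)=|\{1\le s\le k: x\in a_s(n_s)\}|$; $A$ is an $m$-cover of $\mathbb Z$ if $w_A(x)\ge m$ for all $x\in\mathbb Z$. -}

module Defs where

open import Data.Nat as ℕ using (ℕ; zero; suc; NonZero)
open import Data.Nat.Divisibility using (_∣?_)
open import Data.Integer as ℤ using (ℤ; ∣_∣; +_)
open import Data.Rational as ℚ using (ℚ; _/_)
open import Data.Fin using (Fin; zero; suc; toℕ)
open import Data.Fin.Subset using (Subset; Nonempty) renaming (∣_∣ to size) renaming (_∈_ to _∈ₛ_)
open import Data.Vec using (Vec; []; _∷_; tabulate)
open import Data.Bool using (Bool; true; false)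
open import Data.Product using (Σ; ∃; _×_; _,_)
open import Relation.Nullary using (does; ¬_)
open import Relation.Binary.PropositionalEquality using (_≡_)

w : ∀ {k} → (Fin k → ℤ) → (Fin k → ℕ) → ℤ → ℕ
w a n x = size (tabulate (λ s → does (n s ∣? ∣ x ℤ.- a s ∣)))

IsCover : ℕ → ∀ {k} → (Fin k → ℤ) → (Fin k → ℕ) → Set
IsCover m a n = ∀ (x : ℤ) → m ℕ.≤ w a n x

sumOver : ∀ {k} → Subset k → (Fin k → ℚ) → ℚ
sumOver {zero}  []           f = ℚ.0ℚ
sumOver {suc k} (true  ∷ I) f = f zero ℚ.+ sumOver I (λ s → f (suc s))
sumOver {suc k} (false ∷ I) f = sumOver I (λ s → f (suc s))

IsInt : ℚ → Set
IsInt q = ∃ λ (z : ℤ) → q ≡ z / 1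

InMultiples : ℕ → ℚ → Set
InMultiples p q = ∃ λ (z : ℤ) → q ≡ (+ p ℤ.* z) / 1

frac : ∀ {k} (mm : Fin k → ℤ) (n : Fin k → ℕ) → (∀ s → NonZero (n s)) → Fin k → ℚ
frac mm n nz s = _/_ (mm s) (n s) {{nz s}}

-- r (mod p) belongs to { Σ_{s∈I} μ_s mod p : ∅ ≠ I ⊆ {1..k}, Σ_{s∈I} m_s/n_s ∈ ℤ }
-- (Σ_{s∈I} μ_s is an integer under the corollary's hypotheses; we ask Σ μ_s - r ∈ pℤ).
Attained : ∀ {k} (p : ℕ) (fr μ : Fin k → ℚ) → Fin p → Set
Attained p fr μ r =
  ∃ λ (I : Subset _) → Nonempty I × IsInt (sumOver I fr)
    × InMultiples p (sumOver I μ ℚ.- (+ toℕ r) / 1)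

module Submission where

-- Let N = ∏ n_s, so that m_s / n_s = E_s / N with E_s ∈ ℤ. If fewer than m residues were attained,
-- P(t) = ∏ (t - r) over the attained residues r would be a polynomial of degree < m. An inclusion-exclusion
-- over the prime divisors q of N gives an N-periodic integer kernel h with h(0) = 1 such that
-- Σ_{x mod N} h(x e + b) vanishes unless N ∣ e; it replaces the roots of unity of the usual argument.
-- For each x at least m of the classes a_s(n_s) contain x, and h(Σ_{s ∈ I} E_s (x - a_s)) does not see
-- those s, so Σ_I (-1)^|I| h(Σ_{s ∈ I} E_s (x - a_s)) P(Σ_{s ∈ I} μ_s) is an m-th order difference of P
-- and vanishes. Summing over x mod N leaves only the I with Σ_{s ∈ I} m_s / n_s ∈ ℤ, weighted by
-- N h(-Σ_{s ∈ I} E_s a_s). For I ≠ ∅ the residue of Σ_{s ∈ I} μ_s is attained, so p divides P there;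
-- hence N P(0) ≡ 0 (mod N p), whereas p ∤ P(0) because the residue 0 is never attained.

open import Defs
open import Data.Nat using (ℕ; NonZero)
open import Data.Nat.Primality using (Prime)
open import Data.Integer using (ℤ)
open import Data.Rational using (ℚ)
open import Data.Fin using (Fin)
open import Data.Fin.Subset using (Subset; Nonempty)
open import Data.Product using (Σ; ∃; _×_)
open import Relation.Nullary using (¬_)
open import Function.Definitions using (Injective)
open import Relation.Binary.PropositionalEquality using (_≡_)

open import Data.Bool using (true; false)
open import Data.Empty using (⊥-elim)
open import Data.Fin as Fin using (zero; suc; toℕ; fromℕ<)
import Data.Fin.Properties as FinP
open import Data.Fin.Subset using (_∈_; ⊥) renaming (∣_∣ to size)
open import Data.Fin.Subset.Properties using (anySubset?; nonempty?)
open import Data.Integer as ℤ using (+_; +[1+_]; -[1+_])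
open import Data.Integer.Divisibility.Signed
  using (_∣_; _∣?_; divides; ∣m+n∣n⇒∣m; ∣m∣n⇒∣m+n; ∣n⇒∣m*n; ∣-refl)
import Data.Integer.Divisibility.Signed as ℤD
import Data.Integer.DivMod as ℤDM
import Data.Integer.GCD as ℤG
import Data.Integer.Properties as ℤP
open import Data.Integer.Tactic.RingSolver using () renaming (solve-∀ to ℤ-solve-∀)
open import Data.List as List using (List; []; _∷_; length; map; filter; upTo; allFin)
import Data.List.Properties as ListP
open import Data.List.Membership.Propositional using () renaming (_∈_ to _∈ₗ_)
open import Data.List.Membership.Propositional.Properties
  using (∈-filter⁺; ∈-upTo⁺; ∈-allFin; ∈-map⁺; ∈-lookup; ∈-tabulate⁺)
open import Data.List.Relation.Binary.Sublist.Propositional using (_⊆_; []; _∷_; _∷ʳ_)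
open import Data.List.Relation.Binary.Sublist.Propositional.Properties using (All-resp-⊆)
open import Data.List.Relation.Unary.All as All using (All; []; _∷_)
import Data.List.Relation.Unary.All.Properties as AllP
open import Data.List.Relation.Unary.AllPairs as AllPairs using (AllPairs; []; _∷_)
open import Data.List.Relation.Unary.Any using (here; there)
open import Data.List.Relation.Unary.Unique.Propositional using (Unique)
import Data.List.Relation.Unary.Unique.Propositional.Properties as UniqueP
open import Data.Nat as ℕ using (zero; suc)
import Data.Nat.Coprimality as ℕC
open import Data.Nat.Divisibility using (divides)
import Data.Nat.Divisibility as ℕD
open import Data.Nat.DivMod using (m/n*n≡m)
import Data.Nat.DivMod as ℕDM
import Data.Nat.GCD as ℕG
open import Data.Nat.ListAction using (sum; product)
open import Data.Nat.ListAction.Properties using (∈⇒∣product; product≢0)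
open import Data.Nat.Primality using (prime?; prime⇒nonZero; prime⇒nonTrivial; euclidsLemma)
open import Data.Nat.Primality.Factorisation using (factorise; factorisationHasAllPrimeFactors)
import Data.Nat.Properties as ℕP
open import Data.Nat.Tactic.RingSolver using () renaming (solve-∀ to ℕ-solve-∀)
open import Data.Product using (_,_; proj₁; proj₂)
open import Data.Rational as ℚ using (mkℚ; _/_; 0ℚ; 1ℚ; ↥_; ↧_)
import Data.Rational.Properties as ℚP
import Data.Rational.Unnormalised as ℚᵘ
import Data.Rational.Unnormalised.Properties as ℚᵘP
open import Data.Sum using (inj₁; inj₂)
open import Data.Vec as Vec using ([]; _∷_; here; there)
import Data.Vec.Properties as VecP
open import Function using (_∘_)
open import Level using (0ℓ)
open import Relation.Binary.PropositionalEquality using (refl; sym; trans; cong; cong₂; subst; module ≡-Reasoning)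
open import Relation.Nullary using (Dec; yes; no; does)
open import Relation.Nullary.Decidable using (_×-dec_; dec⇒maybe)
open import Tactic.RingSolver using (solve-∀)
import Tactic.RingSolver.Core.AlmostCommutativeRing as ACR
import Algebra
open import Algebra.Properties.Group (Algebra.AbelianGroup.group ℤP.+-0-abelianGroup)
  using () renaming (∙-cancelʳ to +-cancelʳ)

ℚ-ring : ACR.AlmostCommutativeRing 0ℓ 0ℓ
ℚ-ring = ACR.fromCommutativeRing ℚP.+-*-commutativeRing (λ x → dec⇒maybe (0ℚ ℚP.≟ x))

ι : ℤ → ℚ
ι z = z / 1

ι≡mkℚ : ∀ z → ι z ≡ mkℚ z 0 (ℕC.sym (ℕC.1-coprimeTo ℤ.∣ z ∣))
ι≡mkℚ z = normalised (ι z) z numerator denominator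
  where
  gcd[z,1]≡1 : ℤG.gcd z (+ 1) ≡ + 1
  gcd[z,1]≡1 = cong +_ (ℕG.gcd-zeroʳ ℤ.∣ z ∣)
  numerator : ↥ ι z ≡ z
  numerator = trans (sym (ℤP.*-identityʳ _)) (trans (cong (↥ ι z ℤ.*_) (sym gcd[z,1]≡1)) (ℚP.↥-/ z 1))
  denominator : ↧ ι z ≡ + 1
  denominator = trans (sym (ℤP.*-identityʳ _)) (trans (cong (↧ ι z ℤ.*_) (sym gcd[z,1]≡1)) (ℚP.↧-/ z 1))
  normalised : ∀ q z → ↥ q ≡ z → ↧ q ≡ + 1 → q ≡ mkℚ z 0 (ℕC.sym (ℕC.1-coprimeTo ℤ.∣ z ∣))
  normalised (mkℚ _ zero _) _ refl refl = refl

ι-homo-* : ∀ a b → ι (a ℤ.* b) ≡ ι a ℚ.* ι b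
ι-homo-* a b rewrite ι≡mkℚ a | ι≡mkℚ b = refl

ι-homo-+ : ∀ a b → ι (a ℤ.+ b) ≡ ι a ℚ.+ ι b
ι-homo-+ a b rewrite ι≡mkℚ a | ι≡mkℚ b =
  ℚP./-cong (cong₂ ℤ._+_ (sym (ℤP.*-identityʳ a)) (sym (ℤP.*-identityʳ b))) refl

ι-homo-neg : ∀ a → ι (ℤ.- a) ≡ ℚ.- ι a
ι-homo-neg (+ zero)    = refl
ι-homo-neg a@(+[1+ _ ]) rewrite ι≡mkℚ a = refl
ι-homo-neg a@(-[1+ _ ]) rewrite ι≡mkℚ a | ι≡mkℚ (ℤ.- a) = refl

ι-homo-minus : ∀ a b → ι (a ℤ.- b) ≡ ι a ℚ.- ι b
ι-homo-minus a b = trans (ι-homo-+ a (ℤ.- b)) (cong (ι a ℚ.+_) (ι-homo-neg b))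

ι-injective : ∀ {a b} → ι a ≡ ι b → a ≡ b
ι-injective {a} {b} eq = proj₁ (ℚP.mkℚ-injective (trans (sym (ι≡mkℚ a)) (trans eq (ι≡mkℚ b))))

ι-*-/ : ∀ i c d .{{_ : NonZero d}} → ι (+ (c ℕ.* d)) ℚ.* (i / d) ≡ ι (i ℤ.* + c)
ι-*-/ i c d@(suc d-1) = ℚP.toℚᵘ-injective (begin
  ℚ.toℚᵘ (ι (+ (c ℕ.* d)) ℚ.* (i / d))               ≈⟨ ℚP.toℚᵘ-homo-* (ι (+ (c ℕ.* d))) (i / d) ⟩
  ℚ.toℚᵘ (ι (+ (c ℕ.* d))) ℚᵘ.* ℚ.toℚᵘ (i / d)       ≈⟨ ℚᵘP.*-cong (ℚP.toℚᵘ-fromℚᵘ (ℚᵘ.mkℚᵘ (+ (c ℕ.* d)) 0))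
                                                                    (ℚP.toℚᵘ-fromℚᵘ (ℚᵘ.mkℚᵘ i d-1)) ⟩
  ℚᵘ.mkℚᵘ (+ (c ℕ.* d)) 0 ℚᵘ.* ℚᵘ.mkℚᵘ i d-1          ≈⟨ ℚᵘ.*≡* cross-multiplied ⟩
  ℚᵘ.mkℚᵘ (i ℤ.* + c) 0                              ≈⟨ ℚP.toℚᵘ-fromℚᵘ (ℚᵘ.mkℚᵘ (i ℤ.* + c) 0) ⟨
  ℚ.toℚᵘ (ι (i ℤ.* + c))                             ∎)
  where
  open ℚᵘP.≃-Reasoning
  reorder : ∀ c d i → (c ℤ.* d ℤ.* i) ℤ.* + 1 ≡ (i ℤ.* c) ℤ.* d
  reorder = ℤ-solve-∀
  cross-multiplied : (+ (c ℕ.* d) ℤ.* i) ℤ.* + 1 ≡ (i ℤ.* + c) ℤ.* + (1 ℕ.* d)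
  cross-multiplied = trans (cong (λ x → (x ℤ.* i) ℤ.* + 1) (ℤP.pos-* c d))
                    (trans (reorder (+ c) (+ d) i) (cong (λ x → (i ℤ.* + c) ℤ.* + x) (sym (ℕP.*-identityˡ d))))

ι-*-cancelˡ : ∀ n .{{_ : NonZero n}} {a b} → ι (+ n) ℚ.* a ≡ ι (+ n) ℚ.* b → a ≡ b
ι-*-cancelˡ n {a} {b} eq rewrite ι≡mkℚ (+ n) = begin
  a                    ≡⟨ cancel a ⟨
  x⁻¹ ℚ.* (x ℚ.* a)    ≡⟨ cong (x⁻¹ ℚ.*_) eq ⟩
  x⁻¹ ℚ.* (x ℚ.* b)    ≡⟨ cancel b ⟩
  b                    ∎
  where
  open ≡-Reasoning
  x = mkℚ (+ n) 0 (ℕC.sym (ℕC.1-coprimeTo n))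
  x⁻¹ = ℚ.1/ x
  cancel : ∀ y → x⁻¹ ℚ.* (x ℚ.* y) ≡ y
  cancel y = trans (sym (ℚP.*-assoc x⁻¹ x y)) (trans (cong (ℚ._* y) (ℚP.*-inverseˡ x)) (ℚP.*-identityˡ y))

isInt? : ∀ q → Dec (IsInt q)
isInt? (mkℚ i zero    _) = yes (i , sym (ι≡mkℚ i))
isInt? (mkℚ i (suc d) _) = no λ (z , eq) → ℕP.1+n≢0 (proj₂ (ℚP.mkℚ-injective (trans eq (ι≡mkℚ z))))

altSum : ∀ {k} → (Subset k → ℚ) → ℚ
altSum {zero}  f = f []
altSum {suc k} f = altSum (λ I → f (false ∷ I)) ℚ.- altSum (λ I → f (true ∷ I))

altSum-cong : ∀ {k} {f g : Subset k → ℚ} → (∀ I → f I ≡ g I) → altSum f ≡ altSum g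
altSum-cong {zero}  f≡g = f≡g []
altSum-cong {suc k} f≡g =
  cong₂ ℚ._-_ (altSum-cong (λ I → f≡g (false ∷ I))) (altSum-cong (λ I → f≡g (true ∷ I)))

altSum-zero : ∀ {k} {f : Subset k → ℚ} → (∀ I → f I ≡ 0ℚ) → altSum f ≡ 0ℚ
altSum-zero {zero}  f≡0 = f≡0 []
altSum-zero {suc k} f≡0 rewrite altSum-zero (f≡0 ∘ (false ∷_)) | altSum-zero (f≡0 ∘ (true ∷_)) = refl

altSum-+ : ∀ {k} (f g : Subset k → ℚ) → altSum (λ I → f I ℚ.+ g I) ≡ altSum f ℚ.+ altSum g
altSum-+ {zero}  f g = refl
altSum-+ {suc k} f g
  rewrite altSum-+ (λ I → f (false ∷ I)) (λ I → g (false ∷ I))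
        | altSum-+ (λ I → f (true ∷ I)) (λ I → g (true ∷ I)) =
  interchange (altSum (λ I → f (false ∷ I))) (altSum (λ I → g (false ∷ I)))
              (altSum (λ I → f (true ∷ I))) (altSum (λ I → g (true ∷ I)))
  where
  interchange : ∀ a b c d → (a ℚ.+ b) ℚ.- (c ℚ.+ d) ≡ (a ℚ.- c) ℚ.+ (b ℚ.- d)
  interchange = solve-∀ ℚ-ring

altSum-minus : ∀ {k} (f g : Subset k → ℚ) → altSum (λ I → f I ℚ.- g I) ≡ altSum f ℚ.- altSum g
altSum-minus {zero}  f g = refl
altSum-minus {suc k} f g
  rewrite altSum-minus (λ I → f (false ∷ I)) (λ I → g (false ∷ I))
        | altSum-minus (λ I → f (true ∷ I)) (λ I → g (true ∷ I)) =
  interchange (altSum (λ I → f (false ∷ I))) (altSum (λ I → g (false ∷ I)))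
              (altSum (λ I → f (true ∷ I))) (altSum (λ I → g (true ∷ I)))
  where
  interchange : ∀ a b c d → (a ℚ.- b) ℚ.- (c ℚ.- d) ≡ (a ℚ.- c) ℚ.- (b ℚ.- d)
  interchange = solve-∀ ℚ-ring

InMultiples⇒∣ : ∀ {d z} → InMultiples d (ι z) → + d ∣ z
InMultiples⇒∣ {d} (w , eq) = divides w (trans (ι-injective eq) (ℤP.*-comm (+ d) w))

∣⇒InMultiples : ∀ d {z} → + d ∣ z → InMultiples d (ι z)
∣⇒InMultiples d (divides w eq) = w , cong ι (trans eq (ℤP.*-comm w (+ d)))

inMultiples? : ∀ d q → Dec (InMultiples d q)
inMultiples? d q with isInt? q
... | no  q∉ℤ      = no λ (z , eq) → q∉ℤ (+ d ℤ.* z , eq)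
... | yes (z , refl) with + d ∣? z
...   | yes d∣z = yes (∣⇒InMultiples d d∣z)
...   | no  d∤z = no (d∤z ∘ InMultiples⇒∣)

InMultiples-+ : ∀ d {a b} → InMultiples d a → InMultiples d b → InMultiples d (a ℚ.+ b)
InMultiples-+ d (z , refl) (w , refl) =
  z ℤ.+ w , trans (sym (ι-homo-+ (+ d ℤ.* z) (+ d ℤ.* w))) (cong ι (sym (ℤP.*-distribˡ-+ (+ d) z w)))

InMultiples-neg : ∀ d {a} → InMultiples d a → InMultiples d (ℚ.- a)
InMultiples-neg d (z , refl) =
  ℤ.- z , trans (sym (ι-homo-neg (+ d ℤ.* z))) (cong ι (ℤP.neg-distribʳ-* (+ d) z))

InMultiples-altSum : ∀ d {k} (F : Subset k → ℚ) → (∀ I → InMultiples d (F I)) → InMultiples d (altSum F)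
InMultiples-altSum d {zero}  F F∈dℤ = F∈dℤ []
InMultiples-altSum d {suc k} F F∈dℤ = InMultiples-+ d
  (InMultiples-altSum d (λ I → F (false ∷ I)) (λ I → F∈dℤ (false ∷ I)))
  (InMultiples-neg d (InMultiples-altSum d (λ I → F (true ∷ I)) (λ I → F∈dℤ (true ∷ I))))

InMultiples-altSum⇒⊥ : ∀ d {k} (F : Subset k → ℚ) → (∀ I → Nonempty I → InMultiples d (F I)) →
                       InMultiples d (altSum F) → InMultiples d (F ⊥)
InMultiples-altSum⇒⊥ d {zero}  F _ ΣF∈dℤ = ΣF∈dℤ
InMultiples-altSum⇒⊥ d {suc k} F F∈dℤ ΣF∈dℤ =
  InMultiples-altSum⇒⊥ d (λ I → F (false ∷ I)) (λ I (s , s∈I) → F∈dℤ (false ∷ I) (suc s , there s∈I))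
    (subst (InMultiples d) (difference+ (altSum (λ I → F (false ∷ I))) (altSum (λ I → F (true ∷ I))))
      (InMultiples-+ d ΣF∈dℤ
        (InMultiples-altSum d (λ I → F (true ∷ I)) (λ I → F∈dℤ (true ∷ I) (zero , here)))))
  where
  difference+ : ∀ a b → (a ℚ.- b) ℚ.+ b ≡ a
  difference+ = solve-∀ ℚ-ring

DegreeBelow : ℕ → (ℚ → ℚ) → Set
DegreeBelow zero    F = ∀ t → F t ≡ 0ℚ
DegreeBelow (suc d) F = ∀ v → DegreeBelow d (λ t → F t ℚ.- F (t ℚ.+ v))

DegreeBelow-cong : ∀ d {F G : ℚ → ℚ} → (∀ t → F t ≡ G t) → DegreeBelow d F → DegreeBelow d G
DegreeBelow-cong zero    F≡G degF t = trans (sym (F≡G t)) (degF t)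
DegreeBelow-cong (suc d) F≡G degF v =
  DegreeBelow-cong d (λ t → cong₂ ℚ._-_ (F≡G t) (F≡G (t ℚ.+ v))) (degF v)

DegreeBelow-suc : ∀ d {F} → DegreeBelow d F → DegreeBelow (suc d) F
DegreeBelow-suc zero    degF v t rewrite degF t | degF (t ℚ.+ v) = refl
DegreeBelow-suc (suc d) degF v = DegreeBelow-suc d (degF v)

DegreeBelow-mono : ∀ {d d′ F} → d ℕ.≤ d′ → DegreeBelow d F → DegreeBelow d′ F
DegreeBelow-mono {d} {d′} d≤d′ degF with ℕP.≤⇒≤′ d≤d′
... | ℕ.≤′-refl         = degF
... | ℕ.≤′-step {n} d≤n = DegreeBelow-suc n (DegreeBelow-mono (ℕP.≤′⇒≤ d≤n) degF)

DegreeBelow-+ : ∀ d {F G} → DegreeBelow d F → DegreeBelow d G → DegreeBelow d (λ t → F t ℚ.+ G t)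
DegreeBelow-+ zero    degF degG t rewrite degF t | degG t = refl
DegreeBelow-+ (suc d) {F} {G} degF degG v =
  DegreeBelow-cong d (λ t → interchange (F t) (G t) (F (t ℚ.+ v)) (G (t ℚ.+ v)))
    (DegreeBelow-+ d (degF v) (degG v))
  where
  interchange : ∀ a b c e → (a ℚ.- c) ℚ.+ (b ℚ.- e) ≡ (a ℚ.+ b) ℚ.- (c ℚ.+ e)
  interchange = solve-∀ ℚ-ring

DegreeBelow-*ˡ : ∀ d c {F} → DegreeBelow d F → DegreeBelow d (λ t → c ℚ.* F t)
DegreeBelow-*ˡ zero    c degF t rewrite degF t = ℚP.*-zeroʳ c
DegreeBelow-*ˡ (suc d) c {F} degF v =
  DegreeBelow-cong d (λ t → distrib c (F t) (F (t ℚ.+ v))) (DegreeBelow-*ˡ d c (degF v))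
  where
  distrib : ∀ c a b → c ℚ.* (a ℚ.- b) ≡ c ℚ.* a ℚ.- c ℚ.* b
  distrib = solve-∀ ℚ-ring

DegreeBelow-shift : ∀ d w {F} → DegreeBelow d F → DegreeBelow d (λ t → F (t ℚ.+ w))
DegreeBelow-shift zero    w degF t = degF (t ℚ.+ w)
DegreeBelow-shift (suc d) w {F} degF v =
  DegreeBelow-cong d (λ t → cong (λ x → F (t ℚ.+ w) ℚ.- F x) (swap t w v)) (DegreeBelow-shift d w (degF v))
  where
  swap : ∀ t w v → (t ℚ.+ w) ℚ.+ v ≡ (t ℚ.+ v) ℚ.+ w
  swap = solve-∀ ℚ-ring

DegreeBelow-linear* : ∀ d r {F} → DegreeBelow d F → DegreeBelow (suc d) (λ t → (t ℚ.- r) ℚ.* F t)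
DegreeBelow-linear* zero r {F} degF v t
  rewrite degF t | degF (t ℚ.+ v) | ℚP.*-zeroʳ (t ℚ.- r) | ℚP.*-zeroʳ ((t ℚ.+ v) ℚ.- r) = refl
DegreeBelow-linear* (suc d) r {F} degF v =
  DegreeBelow-cong (suc d) (λ t → sym (product-rule t v r (F t) (F (t ℚ.+ v))))
    (DegreeBelow-+ (suc d) {λ t → (t ℚ.- r) ℚ.* (F t ℚ.- F (t ℚ.+ v))}
      (DegreeBelow-linear* d r (degF v))
      (DegreeBelow-*ˡ (suc d) (ℚ.- v) (DegreeBelow-shift (suc d) v {F} degF)))
  where
  product-rule : ∀ t v r a b → (t ℚ.- r) ℚ.* a ℚ.- ((t ℚ.+ v) ℚ.- r) ℚ.* b
                             ≡ (t ℚ.- r) ℚ.* (a ℚ.- b) ℚ.+ (ℚ.- v) ℚ.* b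
  product-rule = solve-∀ ℚ-ring

∏[t-r] : List ℚ → ℚ → ℚ
∏[t-r] []       t = 1ℚ
∏[t-r] (r ∷ rs) t = (t ℚ.- r) ℚ.* ∏[t-r] rs t

DegreeBelow-∏[t-r] : ∀ rs → DegreeBelow (suc (length rs)) (∏[t-r] rs)
DegreeBelow-∏[t-r] []       v t = ℚP.+-inverseʳ 1ℚ
DegreeBelow-∏[t-r] (r ∷ rs) = DegreeBelow-linear* (suc (length rs)) r (DegreeBelow-∏[t-r] rs)

∏[t-r]ℤ : List ℤ → ℤ → ℤ
∏[t-r]ℤ []       z = + 1
∏[t-r]ℤ (r ∷ rs) z = (z ℤ.- r) ℤ.* ∏[t-r]ℤ rs z

∏[t-r]-ι : ∀ rs z → ∏[t-r] (map ι rs) (ι z) ≡ ι (∏[t-r]ℤ rs z)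
∏[t-r]-ι []       z = refl
∏[t-r]-ι (r ∷ rs) z =
  trans (cong₂ ℚ._*_ (sym (ι-homo-minus z r)) (∏[t-r]-ι rs z)) (sym (ι-homo-* (z ℤ.- r) (∏[t-r]ℤ rs z)))

∣∏[t-r]ℤ : ∀ {d rs z r} → r ∈ₗ rs → d ∣ z ℤ.- r → d ∣ ∏[t-r]ℤ rs z
∣∏[t-r]ℤ {rs = r ∷ rs}  {z} (here refl) d∣z-r = ℤD.∣m⇒∣m*n (∏[t-r]ℤ rs z) d∣z-r
∣∏[t-r]ℤ {rs = r′ ∷ rs} {z} (there r∈rs) d∣z-r = ℤD.∣n⇒∣m*n (z ℤ.- r′) (∣∏[t-r]ℤ r∈rs d∣z-r)

prime∤∏[t-r]ℤ : ∀ {p} → Prime p → ∀ {rs z} → All (λ r → ¬ + p ∣ z ℤ.- r) rs → ¬ + p ∣ ∏[t-r]ℤ rs z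
prime∤∏[t-r]ℤ p-prime {[]}     []           p∣1 =
  ℕ.nonTrivial⇒≢1 {{prime⇒nonTrivial p-prime}} (ℕD.∣1⇒≡1 (ℤD.∣⇒∣ᵤ p∣1))
prime∤∏[t-r]ℤ p-prime {r ∷ rs} {z} (p∤z-r ∷ p∤rest) p∣∏
  with euclidsLemma ℤ.∣ z ℤ.- r ∣ ℤ.∣ ∏[t-r]ℤ rs z ∣ p-prime
         (subst (_ ℕD.∣_) (ℤP.abs-* (z ℤ.- r) (∏[t-r]ℤ rs z)) (ℤD.∣⇒∣ᵤ p∣∏))
... | inj₁ p∣z-r = p∤z-r (ℤD.∣ᵤ⇒∣ p∣z-r)
... | inj₂ p∣rest = prime∤∏[t-r]ℤ p-prime p∤rest (ℤD.∣ᵤ⇒∣ p∣rest)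

sumOverℤ : ∀ {k} → Subset k → (Fin k → ℤ) → ℤ
sumOverℤ {zero}  []          f = + 0
sumOverℤ {suc k} (true  ∷ I) f = f zero ℤ.+ sumOverℤ I (λ s → f (suc s))
sumOverℤ {suc k} (false ∷ I) f = sumOverℤ I (λ s → f (suc s))

sumOverℤ-⊥ : ∀ {k} (f : Fin k → ℤ) → sumOverℤ ⊥ f ≡ + 0
sumOverℤ-⊥ {zero}  f = refl
sumOverℤ-⊥ {suc k} f = sumOverℤ-⊥ (f ∘ suc)

sumOver-⊥ : ∀ {k} (f : Fin k → ℚ) → sumOver ⊥ f ≡ 0ℚ
sumOver-⊥ {zero}  f = refl
sumOver-⊥ {suc k} f = sumOver-⊥ (f ∘ suc)

sumOverℤ-linear : ∀ {k} (I : Subset k) X (f g : Fin k → ℤ) →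
                  sumOverℤ I (λ s → X ℤ.* f s ℤ.+ g s) ≡ X ℤ.* sumOverℤ I f ℤ.+ sumOverℤ I g
sumOverℤ-linear {zero}  []          X f g = sym (trans (ℤP.+-identityʳ (X ℤ.* + 0)) (ℤP.*-zeroʳ X))
sumOverℤ-linear {suc k} (false ∷ I) X f g = sumOverℤ-linear I X (f ∘ suc) (g ∘ suc)
sumOverℤ-linear {suc k} (true  ∷ I) X f g rewrite sumOverℤ-linear I X (f ∘ suc) (g ∘ suc) =
  regroup X (f zero) (g zero) (sumOverℤ I (f ∘ suc)) (sumOverℤ I (g ∘ suc))
  where
  regroup : ∀ X a b c d → (X ℤ.* a ℤ.+ b) ℤ.+ (X ℤ.* c ℤ.+ d) ≡ X ℤ.* (a ℤ.+ c) ℤ.+ (b ℤ.+ d)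
  regroup = ℤ-solve-∀

Periodic : ℕ → (ℤ → ℤ) → Set
Periodic N h = ∀ u d → + N ∣ d → h (u ℤ.+ d) ≡ h u

-- A periodic weight h does not see the coordinates s ∈ V, so the alternating sum is an iterated
-- difference of F of order |V|.
altSum-periodic*degreeBelow≡0 :
  ∀ {N h} → Periodic N h → ∀ {k} (V : Subset k) (δ : Fin k → ℤ) (μ : Fin k → ℚ) →
  (∀ {s} → s ∈ V → + N ∣ δ s) → ∀ {F} → DegreeBelow (size V) F → ∀ u c →
  altSum (λ I → ι (h (u ℤ.+ sumOverℤ I δ)) ℚ.* F (c ℚ.+ sumOver I μ)) ≡ 0ℚ
altSum-periodic*degreeBelow≡0 {h = h} _ [] _ _ _ {F} degF u c =
  trans (cong (ι (h (u ℤ.+ + 0)) ℚ.*_) (degF (c ℚ.+ 0ℚ))) (ℚP.*-zeroʳ (ι (h (u ℤ.+ + 0))))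
altSum-periodic*degreeBelow≡0 {N} {h} h-per (true ∷ V) δ μ N∣δ {F} degF u c = begin
  altSum f₀ ℚ.- altSum f₁                 ≡⟨ altSum-minus f₀ f₁ ⟨
  altSum (λ I → f₀ I ℚ.- f₁ I)            ≡⟨ altSum-cong difference ⟩
  altSum (λ I → h′ I ℚ.* ΔF (c ℚ.+ μ′ I))
    ≡⟨ altSum-periodic*degreeBelow≡0 h-per V (δ ∘ suc) (μ ∘ suc) (N∣δ ∘ there) (degF (μ zero)) u c ⟩
  0ℚ                                      ∎
  where
  open ≡-Reasoning
  δ′ : Subset _ → ℤ
  δ′ I = sumOverℤ I (δ ∘ suc)
  μ′ : Subset _ → ℚ
  μ′ I = sumOver I (μ ∘ suc)
  h′ : Subset _ → ℚ
  h′ I = ι (h (u ℤ.+ δ′ I))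
  f₀ f₁ : Subset _ → ℚ
  f₀ I = h′ I ℚ.* F (c ℚ.+ μ′ I)
  f₁ I = ι (h (u ℤ.+ (δ zero ℤ.+ δ′ I))) ℚ.* F (c ℚ.+ (μ zero ℚ.+ μ′ I))
  ΔF : ℚ → ℚ
  ΔF t = F t ℚ.- F (t ℚ.+ μ zero)
  difference : ∀ I → f₀ I ℚ.- f₁ I ≡ h′ I ℚ.* ΔF (c ℚ.+ μ′ I)
  difference I = begin
    f₀ I ℚ.- f₁ I
      ≡⟨ cong₂ (λ x y → f₀ I ℚ.- ι (h x) ℚ.* F y) (ℤ-swap u (δ zero) (δ′ I)) (ℚ-swap c (μ zero) (μ′ I)) ⟩
    f₀ I ℚ.- ι (h ((u ℤ.+ δ′ I) ℤ.+ δ zero)) ℚ.* F ((c ℚ.+ μ′ I) ℚ.+ μ zero)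
      ≡⟨ cong (λ x → f₀ I ℚ.- ι x ℚ.* F ((c ℚ.+ μ′ I) ℚ.+ μ zero)) (h-per _ _ (N∣δ here)) ⟩
    h′ I ℚ.* F (c ℚ.+ μ′ I) ℚ.- h′ I ℚ.* F ((c ℚ.+ μ′ I) ℚ.+ μ zero)
      ≡⟨ distrib (h′ I) (F (c ℚ.+ μ′ I)) (F ((c ℚ.+ μ′ I) ℚ.+ μ zero)) ⟨
    h′ I ℚ.* ΔF (c ℚ.+ μ′ I) ∎
    where
    ℤ-swap : ∀ u a b → u ℤ.+ (a ℤ.+ b) ≡ (u ℤ.+ b) ℤ.+ a
    ℤ-swap = ℤ-solve-∀
    ℚ-swap : ∀ u a b → u ℚ.+ (a ℚ.+ b) ≡ (u ℚ.+ b) ℚ.+ a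
    ℚ-swap = solve-∀ ℚ-ring
    distrib : ∀ x a b → x ℚ.* (a ℚ.- b) ≡ x ℚ.* a ℚ.- x ℚ.* b
    distrib = solve-∀ ℚ-ring
altSum-periodic*degreeBelow≡0 {N} {h} h-per (false ∷ V) δ μ N∣δ {F} degF u c =
  cong₂ ℚ._-_ (IH u c) (trans (altSum-cong reassociate) (IH (u ℤ.+ δ zero) (c ℚ.+ μ zero)))
  where
  IH = altSum-periodic*degreeBelow≡0 h-per V (δ ∘ suc) (μ ∘ suc) (N∣δ ∘ there) degF
  reassociate : ∀ I → ι (h (u ℤ.+ (δ zero ℤ.+ sumOverℤ I (δ ∘ suc)))) ℚ.* F (c ℚ.+ (μ zero ℚ.+ sumOver I (μ ∘ suc)))
                    ≡ ι (h ((u ℤ.+ δ zero) ℤ.+ sumOverℤ I (δ ∘ suc))) ℚ.* F ((c ℚ.+ μ zero) ℚ.+ sumOver I (μ ∘ suc))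
  reassociate I = cong₂ (λ x y → ι (h x) ℚ.* F y) (sym (ℤP.+-assoc u _ _)) (sym (ℚP.+-assoc c _ _))

sumℤ : ℕ → (ℕ → ℤ) → ℤ
sumℤ zero    g = + 0
sumℤ (suc n) g = sumℤ n g ℤ.+ g n

sumℤ-cong : ∀ n {f g : ℕ → ℤ} → (∀ x → f x ≡ g x) → sumℤ n f ≡ sumℤ n g
sumℤ-cong zero    f≡g = refl
sumℤ-cong (suc n) f≡g = cong₂ ℤ._+_ (sumℤ-cong n f≡g) (f≡g n)

sumℤ-minus : ∀ n (f g : ℕ → ℤ) → sumℤ n (λ x → f x ℤ.- g x) ≡ sumℤ n f ℤ.- sumℤ n g
sumℤ-minus zero    f g = refl
sumℤ-minus (suc n) f g rewrite sumℤ-minus n f g = interchange (sumℤ n f) (sumℤ n g) (f n) (g n)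
  where
  interchange : ∀ a b c d → (a ℤ.- b) ℤ.+ (c ℤ.- d) ≡ (a ℤ.+ c) ℤ.- (b ℤ.+ d)
  interchange = ℤ-solve-∀

sumℤ-const : ∀ n c → sumℤ n (λ _ → c) ≡ + n ℤ.* c
sumℤ-const zero    c = sym (ℤP.*-zeroˡ c)
sumℤ-const (suc n) c rewrite sumℤ-const n c = sym (trans (ℤP.suc-* (+ n) c) (ℤP.+-comm c _))

sumℤ-telescope : ∀ n g → sumℤ n (λ x → g (suc x)) ℤ.+ g 0 ≡ sumℤ n g ℤ.+ g n
sumℤ-telescope zero    g = refl
sumℤ-telescope (suc n) g = begin
  (sumℤ n (g ∘ suc) ℤ.+ g (suc n)) ℤ.+ g 0  ≡⟨ swap (sumℤ n (g ∘ suc)) (g (suc n)) (g 0) ⟩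
  (sumℤ n (g ∘ suc) ℤ.+ g 0) ℤ.+ g (suc n)  ≡⟨ cong (ℤ._+ g (suc n)) (sumℤ-telescope n g) ⟩
  (sumℤ n g ℤ.+ g n) ℤ.+ g (suc n)          ∎
  where
  open ≡-Reasoning
  swap : ∀ a b c → (a ℤ.+ b) ℤ.+ c ≡ (a ℤ.+ c) ℤ.+ b
  swap = ℤ-solve-∀

sumℤ-rotate : ∀ n g → (∀ x → g (x ℕ.+ n) ≡ g x) → ∀ t → sumℤ n (λ x → g (x ℕ.+ t)) ≡ sumℤ n g
sumℤ-rotate n g g-per zero    = sumℤ-cong n (λ x → cong g (ℕP.+-identityʳ x))
sumℤ-rotate n g g-per (suc t) = begin
  sumℤ n (λ x → g (x ℕ.+ suc t))    ≡⟨ sumℤ-cong n (λ x → cong g (ℕP.+-suc x t)) ⟩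
  sumℤ n (λ x → g (suc x ℕ.+ t))    ≡⟨ +-cancelʳ (g t) _ _ one-step ⟩
  sumℤ n (λ x → g (x ℕ.+ t))        ≡⟨ sumℤ-rotate n g g-per t ⟩
  sumℤ n g                          ∎
  where
  open ≡-Reasoning
  one-step : sumℤ n (λ x → g (suc x ℕ.+ t)) ℤ.+ g t ≡ sumℤ n (λ x → g (x ℕ.+ t)) ℤ.+ g t
  one-step = trans (sumℤ-telescope n (λ x → g (x ℕ.+ t)))
                   (cong (λ y → sumℤ n (λ x → g (x ℕ.+ t)) ℤ.+ y) (trans (cong g (ℕP.+-comm n t)) (g-per t)))

altSum-ι-sumℤ≡0 : ∀ {k} n (g : ℕ → Subset k → ℤ) (F : Subset k → ℚ) →
                  (∀ x → altSum (λ I → ι (g x I) ℚ.* F I) ≡ 0ℚ) →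
                  altSum (λ I → ι (sumℤ n (λ x → g x I)) ℚ.* F I) ≡ 0ℚ
altSum-ι-sumℤ≡0 zero    g F _     = altSum-zero (λ I → ℚP.*-zeroˡ (F I))
altSum-ι-sumℤ≡0 (suc n) g F each≡0 = begin
  altSum (λ I → ι (sumℤ n (λ x → g x I) ℤ.+ g n I) ℚ.* F I)
    ≡⟨ altSum-cong (λ I → trans (cong (ℚ._* F I) (ι-homo-+ (sumℤ n (λ x → g x I)) (g n I)))
                                (ℚP.*-distribʳ-+ (F I) (ι (sumℤ n (λ x → g x I))) (ι (g n I)))) ⟩
  altSum (λ I → ι (sumℤ n (λ x → g x I)) ℚ.* F I ℚ.+ ι (g n I) ℚ.* F I)
    ≡⟨ altSum-+ (λ I → ι (sumℤ n (λ x → g x I)) ℚ.* F I) (λ I → ι (g n I) ℚ.* F I) ⟩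
  altSum (λ I → ι (sumℤ n (λ x → g x I)) ℚ.* F I) ℚ.+ altSum (λ I → ι (g n I) ℚ.* F I)
    ≡⟨ cong₂ ℚ._+_ (altSum-ι-sumℤ≡0 n g F each≡0) (each≡0 n) ⟩
  0ℚ ∎
  where open ≡-Reasoning

module Kernel (N : ℕ) where

  indicator : ℤ → ℤ
  indicator u with + N ∣? u
  ... | yes _ = + 1
  ... | no  _ = + 0

  indicator-periodic : Periodic N indicator
  indicator-periodic u d N∣d with + N ∣? u ℤ.+ d | + N ∣? u
  ... | yes _       | yes _     = refl
  ... | no  _       | no  _     = refl
  ... | yes N∣u+d   | no  N∤u   = ⊥-elim (N∤u (∣m+n∣n⇒∣m N∣u+d N∣d))
  ... | no  N∤u+d   | yes N∣u   = ⊥-elim (N∤u+d (∣m∣n⇒∣m+n N∣u N∣d))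

  indicator-yes : ∀ {u} → + N ∣ u → indicator u ≡ + 1
  indicator-yes {u} N∣u with + N ∣? u
  ... | yes _   = refl
  ... | no  N∤u = ⊥-elim (N∤u N∣u)

  indicator-no : ∀ {u} → ¬ + N ∣ u → indicator u ≡ + 0
  indicator-no {u} N∤u with + N ∣? u
  ... | yes N∣u = ⊥-elim (N∤u N∣u)
  ... | no  _   = refl

  kernel : {A : Set} → (A → ℕ) → List A → ℤ → ℤ
  kernel f []       u = indicator u
  kernel f (a ∷ as) u = kernel f as u ℤ.- kernel f as (u ℤ.+ + f a)

  kernel-periodic : {A : Set} (f : A → ℕ) (as : List A) → Periodic N (kernel f as)
  kernel-periodic f []       = indicator-periodic
  kernel-periodic f (a ∷ as) u d N∣d =
    cong₂ ℤ._-_ (kernel-periodic f as u d N∣d)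
      (trans (cong (kernel f as) (swap u d (+ f a))) (kernel-periodic f as (u ℤ.+ + f a) d N∣d))
    where
    swap : ∀ u d w → (u ℤ.+ d) ℤ.+ w ≡ (u ℤ.+ w) ℤ.+ d
    swap = ℤ-solve-∀

  private
    shift-sum : ∀ {A : Set} (f : A → ℕ) u a Q →
                (u ℤ.+ + f a) ℤ.+ + sum (map f Q) ≡ u ℤ.+ + sum (map f (a ∷ Q))
    shift-sum f u a Q = trans (ℤP.+-assoc u _ _) (cong (λ x → u ℤ.+ x) (sym (ℤP.pos-+ (f a) _)))

  kernel≡0 : {A : Set} (f : A → ℕ) (as : List A) (u : ℤ) →
             (∀ {Q} → Q ⊆ as → ¬ + N ∣ u ℤ.+ + sum (map f Q)) → kernel f as u ≡ + 0
  kernel≡0 f []       u N∤ = indicator-no (λ N∣u → N∤ [] (subst (+ N ∣_) (sym (ℤP.+-identityʳ u)) N∣u))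
  kernel≡0 f (a ∷ as) u N∤ = cong₂ ℤ._-_
    (kernel≡0 f as u (λ Q⊆as → N∤ (a ∷ʳ Q⊆as)))
    (kernel≡0 f as (u ℤ.+ + f a) (λ {Q} Q⊆as N∣ →
      N∤ (refl ∷ Q⊆as) (subst (+ N ∣_) (shift-sum f u a Q) N∣)))

  kernel[0]≡1 : {A : Set} (f : A → ℕ) (as : List A) →
                (∀ {Q} → Q ⊆ as → N ℕD.∣ sum (map f Q) → Q ≡ []) → kernel f as (+ 0) ≡ + 1
  kernel[0]≡1 f []       _     = indicator-yes (ℤD.∣ᵤ⇒∣ (N ℕD.∣0))
  kernel[0]≡1 f (a ∷ as) only[] = cong₂ ℤ._-_
    (kernel[0]≡1 f as (λ Q⊆as → only[] (a ∷ʳ Q⊆as)))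
    (kernel≡0 f as (+ 0 ℤ.+ + f a) (λ {Q} Q⊆as N∣ → ∷≢[] (only[] (refl ∷ Q⊆as) (N∣sum Q N∣))))
    where
    ∷≢[] : ∀ {Q} → ¬ _≡_ {A = List _} (a ∷ Q) []
    ∷≢[] ()
    N∣sum : ∀ Q → + N ∣ (+ 0 ℤ.+ + f a) ℤ.+ + sum (map f Q) → N ℕD.∣ sum (map f (a ∷ Q))
    N∣sum Q N∣ = ℤD.∣⇒∣ᵤ (subst (+ N ∣_) (trans (shift-sum f (+ 0) a Q) (ℤP.+-identityˡ (+ sum (map f (a ∷ Q))))) N∣)

  kernel-sum≡0 : {A : Set} (f : A → ℕ) {as : List A} {a : A} → a ∈ₗ as →
                 ∀ e t → + N ∣ + t ℤ.* e ℤ.- + f a →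
                 ∀ b → sumℤ N (λ x → kernel f as (+ x ℤ.* e ℤ.+ b)) ≡ + 0
  kernel-sum≡0 f {a ∷ as} (here refl) e t N∣te-fa b = begin
    sumℤ N (λ x → k (X x) ℤ.- k (X x ℤ.+ + f a))
      ≡⟨ sumℤ-minus N (k ∘ X) (λ x → k (X x ℤ.+ + f a)) ⟩
    sumℤ N (k ∘ X) ℤ.- sumℤ N (λ x → k (X x ℤ.+ + f a))
      ≡⟨ cong (λ y → sumℤ N (k ∘ X) ℤ.- y) shifted-sum ⟩
    sumℤ N (k ∘ X) ℤ.- sumℤ N (k ∘ X)
      ≡⟨ ℤP.+-inverseʳ (sumℤ N (k ∘ X)) ⟩
    + 0 ∎
    where
    open ≡-Reasoning
    k : ℤ → ℤ
    k = kernel f as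
    X : ℕ → ℤ
    X x = + x ℤ.* e ℤ.+ b
    rearrange : ∀ x t e b w → (x ℤ.* e ℤ.+ b ℤ.+ w) ℤ.+ (t ℤ.* e ℤ.- w) ≡ (x ℤ.+ t) ℤ.* e ℤ.+ b
    rearrange = ℤ-solve-∀
    X-+ : ∀ x y → X (x ℕ.+ y) ≡ X x ℤ.+ + y ℤ.* e
    X-+ x y = trans (cong (λ z → z ℤ.* e ℤ.+ b) (ℤP.pos-+ x y)) (swap (+ x) (+ y) e b)
      where
      swap : ∀ x y e b → (x ℤ.+ y) ℤ.* e ℤ.+ b ≡ (x ℤ.* e ℤ.+ b) ℤ.+ y ℤ.* e
      swap = ℤ-solve-∀
    shifted-sum : sumℤ N (λ x → k (X x ℤ.+ + f a)) ≡ sumℤ N (k ∘ X)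
    shifted-sum = begin
      sumℤ N (λ x → k (X x ℤ.+ + f a))
        ≡⟨ sumℤ-cong N (λ x → kernel-periodic f as (X x ℤ.+ + f a) _ N∣te-fa) ⟨
      sumℤ N (λ x → k ((X x ℤ.+ + f a) ℤ.+ (+ t ℤ.* e ℤ.- + f a)))
        ≡⟨ sumℤ-cong N (λ x → cong k (trans (rearrange (+ x) (+ t) e b (+ f a))
                                            (cong (λ z → z ℤ.* e ℤ.+ b) (sym (ℤP.pos-+ x t))))) ⟩
      sumℤ N (λ x → k (X (x ℕ.+ t)))    ≡⟨ sumℤ-rotate N (k ∘ X) X-periodic t ⟩
      sumℤ N (k ∘ X)                    ∎
      where
      X-periodic : ∀ x → k (X (x ℕ.+ N)) ≡ k (X x)
      X-periodic x = trans (cong k (X-+ x N)) (kernel-periodic f as (X x) (+ N ℤ.* e) (ℤD.∣m⇒∣m*n e ∣-refl))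
  kernel-sum≡0 f {a′ ∷ as} (there a∈as) e t N∣te-fa b = begin
    sumℤ N (λ x → k (X x) ℤ.- k (X x ℤ.+ + f a′))
      ≡⟨ sumℤ-minus N (k ∘ X) (λ x → k (X x ℤ.+ + f a′)) ⟩
    sumℤ N (k ∘ X) ℤ.- sumℤ N (λ x → k (X x ℤ.+ + f a′))
      ≡⟨ cong₂ ℤ._-_ (IH b) (trans (sumℤ-cong N reassoc) (IH (b ℤ.+ + f a′))) ⟩
    + 0 ∎
    where
    open ≡-Reasoning
    k : ℤ → ℤ
    k = kernel f as
    X : ℕ → ℤ
    X x = + x ℤ.* e ℤ.+ b
    IH = kernel-sum≡0 f a∈as e t N∣te-fa
    reassoc : ∀ x → k (X x ℤ.+ + f a′) ≡ k (+ x ℤ.* e ℤ.+ (b ℤ.+ + f a′))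
    reassoc x = cong k (ℤP.+-assoc (+ x ℤ.* e) b (+ f a′))

AllPairs-resp-⊆ : {A : Set} {R : A → A → Set} {xs ys : List A} → xs ⊆ ys → AllPairs R ys → AllPairs R xs
AllPairs-resp-⊆ []         []           = []
AllPairs-resp-⊆ (_ ∷ʳ τ)   (_ ∷ Rys)    = AllPairs-resp-⊆ τ Rys
AllPairs-resp-⊆ (refl ∷ τ) (Ry ∷ Rys)   = All-resp-⊆ τ Ry ∷ AllPairs-resp-⊆ τ Rys

pos-+* : ∀ d u v w z → d ℕ.+ u ℕ.* v ≡ w ℕ.* z → + d ℤ.+ + u ℤ.* + v ≡ + w ℤ.* + z
pos-+* d u v w z eq = begin
  + d ℤ.+ + u ℤ.* + v  ≡⟨ cong (λ x → + d ℤ.+ x) (ℤP.pos-* u v) ⟨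
  + (d ℕ.+ u ℕ.* v)    ≡⟨ cong +_ eq ⟩
  + (w ℕ.* z)          ≡⟨ ℤP.pos-* w z ⟩
  + w ℤ.* + z          ∎
  where open ≡-Reasoning

∃-prime-divisor : ∀ M → .{{NonZero M}} → ¬ M ≡ 1 → ∃ λ q → Prime q × q ℕD.∣ M
∃-prime-divisor M M≢1 with factorise M
... | record { factors = []     ; isFactorisation = M≡1 } = ⊥-elim (M≢1 M≡1)
... | record { factors = q ∷ qs ; isFactorisation = M≡∏ ; factorsPrime = q-prime ∷ _ } =
  q , q-prime , divides (product qs) (trans M≡∏ (ℕP.*-comm q (product qs)))

module PrimeDivisors (N : ℕ) {{N≢0 : NonZero N}} where

  IsPrimeDivisor : ℕ → Set
  IsPrimeDivisor q = Prime q × q ℕD.∣ N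

  isPrimeDivisor? : ∀ q → Dec (IsPrimeDivisor q)
  isPrimeDivisor? q = prime? q ×-dec q ℕD.∣? N

  primeDivisors : List ℕ
  primeDivisors = filter isPrimeDivisor? (upTo (suc N))

  primeDivisors-sound : All IsPrimeDivisor primeDivisors
  primeDivisors-sound = AllP.all-filter isPrimeDivisor? (upTo (suc N))

  primeDivisors-unique : Unique primeDivisors
  primeDivisors-unique = UniqueP.filter⁺ isPrimeDivisor? (UniqueP.upTo⁺ (suc N))

  primeDivisors-complete : ∀ {q} → Prime q → q ℕD.∣ N → q ∈ₗ primeDivisors
  primeDivisors-complete q-prime q∣N =
    ∈-filter⁺ isPrimeDivisor? (∈-upTo⁺ (ℕ.s≤s (ℕD.∣⇒≤ q∣N))) (q-prime , q∣N)

  -- N / q, with the junk value 0 at q = 0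
  cofactor : ℕ → ℕ
  cofactor zero    = 0
  cofactor (suc q) = N ℕ./ suc q

  cofactor*q≡N : ∀ {q} → q ℕD.∣ N → cofactor q ℕ.* q ≡ N
  cofactor*q≡N {zero}  0∣N = sym (ℕD.0∣⇒≡0 0∣N)
  cofactor*q≡N {suc q} q∣N = m/n*n≡m q∣N

  N∣∏*sum-cofactors : ∀ R → All (ℕD._∣ N) R → N ℕD.∣ product R ℕ.* sum (map cofactor R)
  N∣∏*sum-cofactors []      _            = N ℕD.∣0
  N∣∏*sum-cofactors (r ∷ R) (r∣N ∷ R∣N) = subst (N ℕD.∣_) (sym expand)
      (ℕD.∣m∣n⇒∣m+n (ℕD.∣n⇒∣m*n (product R) ℕD.∣-refl) (ℕD.∣n⇒∣m*n r (N∣∏*sum-cofactors R R∣N)))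
    where
    distribute : ∀ r P c S → (r ℕ.* P) ℕ.* (c ℕ.+ S) ≡ P ℕ.* (c ℕ.* r) ℕ.+ r ℕ.* (P ℕ.* S)
    distribute = ℕ-solve-∀
    expand : product (r ∷ R) ℕ.* sum (map cofactor (r ∷ R))
           ≡ product R ℕ.* N ℕ.+ r ℕ.* (product R ℕ.* sum (map cofactor R))
    expand = trans (distribute r (product R) (cofactor r) (sum (map cofactor R)))
                   (cong (λ x → product R ℕ.* x ℕ.+ r ℕ.* (product R ℕ.* sum (map cofactor R)))
                         (cofactor*q≡N r∣N))

  -- Multiplying the sum by ∏ R kills every weight N/r with r ∈ R, so N ∣ (∏ R)·(N/q) and q ∣ ∏ R.
  cofactors-independent : ∀ {Q} → Q ⊆ primeDivisors → N ℕD.∣ sum (map cofactor Q) → Q ≡ []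
  cofactors-independent {[]}    _ _ = refl
  cofactors-independent {q ∷ R} Q⊆ N∣sum = ⊥-elim (All.lookup q∉R q∈R refl)
    where
    Q-sound = All-resp-⊆ Q⊆ primeDivisors-sound
    q-prime = proj₁ (All.head Q-sound)
    q∣N = proj₂ (All.head Q-sound)
    q∉R : All (λ r → ¬ q ≡ r) R
    q∉R = AllPairs.head (AllPairs-resp-⊆ Q⊆ primeDivisors-unique)
    split-sum : product R ℕ.* sum (map cofactor (q ∷ R))
              ≡ product R ℕ.* sum (map cofactor R) ℕ.+ product R ℕ.* cofactor q
    split-sum = trans (ℕP.*-distribˡ-+ (product R) (cofactor q) _) (ℕP.+-comm (product R ℕ.* cofactor q) _)
    N∣∏*cofactor : N ℕD.∣ product R ℕ.* cofactor q
    N∣∏*cofactor = ℕD.∣m+n∣m⇒∣n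
      (subst (N ℕD.∣_) split-sum (ℕD.∣n⇒∣m*n (product R) N∣sum))
      (N∣∏*sum-cofactors R (All.map proj₂ (All.tail Q-sound)))
    instance
      cofactor≢0 : NonZero (cofactor q)
      cofactor≢0 = ℕP.m*n≢0⇒m≢0 (cofactor q) {{subst NonZero (sym (cofactor*q≡N q∣N)) N≢0}}
    q∣∏ : q ℕD.∣ product R
    q∣∏ = ℕD.*-cancelʳ-∣ (cofactor q)
      (subst (ℕD._∣ product R ℕ.* cofactor q) (trans (sym (cofactor*q≡N q∣N)) (ℕP.*-comm (cofactor q) q))
             N∣∏*cofactor)
    q∈R : q ∈ₗ R
    q∈R = factorisationHasAllPrimeFactors q-prime q∣∏ (All.map proj₁ (All.tail Q-sound))

  bezout : ∀ a → ∃ λ (t : ℤ) → + N ∣ t ℤ.* + a ℤ.- + ℕG.gcd a N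
  bezout a with ℕG.Bézout.identity (ℕG.gcd-GCD a N)
  ... | ℕG.Bézout.+- x y g+yN≡xa = + x , divides (+ y) (begin
    + x ℤ.* + a ℤ.- + g                  ≡⟨ cong (ℤ._- + g) (pos-+* g y N x a g+yN≡xa) ⟨
    (+ g ℤ.+ + y ℤ.* + N) ℤ.- + g        ≡⟨ cancel (+ g) (+ y ℤ.* + N) ⟩
    + y ℤ.* + N                          ∎)
    where
    open ≡-Reasoning
    g = ℕG.gcd a N
    cancel : ∀ g z → (g ℤ.+ z) ℤ.- g ≡ z
    cancel = ℤ-solve-∀
  ... | ℕG.Bézout.-+ x y g+xa≡yN = ℤ.- + x , divides (ℤ.- + y) (begin
    ℤ.- + x ℤ.* + a ℤ.- + g              ≡⟨ negate (+ x) (+ a) (+ g) ⟩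
    ℤ.- (+ g ℤ.+ + x ℤ.* + a)            ≡⟨ cong ℤ.-_ (pos-+* g x a y N g+xa≡yN) ⟩
    ℤ.- (+ y ℤ.* + N)                    ≡⟨ ℤP.neg-distribˡ-* (+ y) (+ N) ⟩
    ℤ.- + y ℤ.* + N                      ∎)
    where
    open ≡-Reasoning
    g = ℕG.gcd a N
    negate : ∀ x a g → ℤ.- x ℤ.* a ℤ.- g ≡ ℤ.- (g ℤ.+ x ℤ.* a)
    negate = ℤ-solve-∀

  bezout-signed : ∀ e → ∃ λ (t : ℤ) → + N ∣ t ℤ.* e ℤ.- + ℕG.gcd ℤ.∣ e ∣ N
  bezout-signed e with bezout ℤ.∣ e ∣ | ℤP.+∣i∣≡i⊎+∣i∣≡-i e
  ... | t , N∣ | inj₁ +∣e∣≡e  = t , subst (λ x → + N ∣ t ℤ.* x ℤ.- + g) +∣e∣≡e N∣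
    where
    g = ℕG.gcd ℤ.∣ e ∣ N
  ... | t , N∣ | inj₂ +∣e∣≡-e = ℤ.- t , subst (λ x → + N ∣ x ℤ.- + g) t*[-e]≡[-t]*e N∣
    where
    g = ℕG.gcd ℤ.∣ e ∣ N
    t*[-e]≡[-t]*e : t ℤ.* + ℤ.∣ e ∣ ≡ ℤ.- t ℤ.* e
    t*[-e]≡[-t]*e = trans (cong (t ℤ.*_) +∣e∣≡-e) (trans (sym (ℤP.neg-distribʳ-* t e)) (ℤP.neg-distribˡ-* t e))

  natural-multiplier : ∀ {e G} → (∃ λ (t : ℤ) → + N ∣ t ℤ.* e ℤ.- G) →
                                  ∃ λ (t : ℕ) → + N ∣ + t ℤ.* e ℤ.- G
  natural-multiplier {e} {G} (t , N∣te-G) = t ℤDM.% + N ,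
    subst (+ N ∣_) reduce (ℤD.∣m∣n⇒∣m-n N∣te-G (ℤD.∣m⇒∣m*n e (ℤD.∣n⇒∣m*n (t ℤDM./ + N) ∣-refl)))
    where
    r = + (t ℤDM.% + N)
    q = t ℤDM./ + N
    cancel : ∀ r q n e g → ((r ℤ.+ q ℤ.* n) ℤ.* e ℤ.- g) ℤ.- q ℤ.* n ℤ.* e ≡ r ℤ.* e ℤ.- g
    cancel = ℤ-solve-∀
    reduce : (t ℤ.* e ℤ.- G) ℤ.- q ℤ.* + N ℤ.* e ≡ r ℤ.* e ℤ.- G
    reduce = trans (cong (λ x → (x ℤ.* e ℤ.- G) ℤ.- q ℤ.* + N ℤ.* e) (ℤDM.a≡a%n+[a/n]*n t (+ N)))
                   (cancel r q (+ N) e G)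

  -- If N ∤ e, the multiples of e modulo N form the proper subgroup generated by g = gcd(e, N), which
  -- contains N/q for any prime q dividing N/g.
  exists-shift : ∀ e → ¬ + N ∣ e →
                 ∃ λ q → q ∈ₗ primeDivisors × ∃ λ (t : ℕ) → + N ∣ + t ℤ.* e ℤ.- + cofactor q
  exists-shift e N∤e with bezout-signed e | ℕG.gcd[m,n]∣n ℤ.∣ e ∣ N
  ... | t , N∣te-g | divides M N≡M*g with ∃-prime-divisor M {{M≢0}} M≢1
    where
    g = ℕG.gcd ℤ.∣ e ∣ N
    M≢0 : NonZero M
    M≢0 = ℕP.m*n≢0⇒m≢0 M {{subst NonZero N≡M*g N≢0}}
    M≢1 : ¬ M ≡ 1
    M≢1 M≡1 = N∤e (ℤD.∣ᵤ⇒∣ (subst (ℕD._∣ ℤ.∣ e ∣) g≡N (ℕG.gcd[m,n]∣m ℤ.∣ e ∣ N)))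
      where
      g≡N : g ≡ N
      g≡N = sym (trans N≡M*g (trans (cong (ℕ._* g) M≡1) (ℕP.*-identityˡ g)))
  ... | q , q-prime , divides j M≡j*q =
    q , primeDivisors-complete q-prime q∣N ,
    natural-multiplier (t ℤ.* + j , subst (+ N ∣_) scaled (ℤD.∣n⇒∣m*n (+ j) N∣te-g))
    where
    g = ℕG.gcd ℤ.∣ e ∣ N
    N≡[j*g]*q : N ≡ (j ℕ.* g) ℕ.* q
    N≡[j*g]*q = trans N≡M*g (trans (cong (ℕ._* g) M≡j*q) (rearrange j q g))
      where
      rearrange : ∀ j q g → (j ℕ.* q) ℕ.* g ≡ (j ℕ.* g) ℕ.* q
      rearrange = ℕ-solve-∀
    q∣N : q ℕD.∣ N
    q∣N = divides (j ℕ.* g) N≡[j*g]*q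
    cofactor≡j*g : cofactor q ≡ j ℕ.* g
    cofactor≡j*g = ℕP.*-cancelʳ-≡ (cofactor q) (j ℕ.* g) q {{prime⇒nonZero q-prime}}
                     (trans (cofactor*q≡N q∣N) N≡[j*g]*q)
    distribute : ∀ j t e g → j ℤ.* (t ℤ.* e ℤ.- g) ≡ (t ℤ.* j) ℤ.* e ℤ.- j ℤ.* g
    distribute = ℤ-solve-∀
    scaled : + j ℤ.* (t ℤ.* e ℤ.- + g) ≡ (t ℤ.* + j) ℤ.* e ℤ.- + cofactor q
    scaled = trans (distribute (+ j) t e (+ g))
                   (cong (λ x → (t ℤ.* + j) ℤ.* e ℤ.- x) (trans (sym (ℤP.pos-* j g)) (cong +_ (sym cofactor≡j*g))))

Unique⇒lookup-injective : {A : Set} {xs : List A} → Unique xs → Injective _≡_ _≡_ (List.lookup xs)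
Unique⇒lookup-injective {xs = x ∷ xs} (x∉xs ∷ _)         {zero}  {zero}  _  = refl
Unique⇒lookup-injective {xs = x ∷ xs} (x∉xs ∷ _)         {zero}  {suc j} eq = ⊥-elim (All.lookup x∉xs (∈-lookup j) eq)
Unique⇒lookup-injective {xs = x ∷ xs} (x∉xs ∷ _)         {suc i} {zero}  eq =
  ⊥-elim (All.lookup x∉xs (∈-lookup i) (sym eq))
Unique⇒lookup-injective {xs = x ∷ xs} (_ ∷ xs-unique)    {suc i} {suc j} eq =
  cong suc (Unique⇒lookup-injective xs-unique eq)

injection-into-list : ∀ {A : Set} {P : A → Set} {m} (xs : List A) → Unique xs → All P xs → m ℕ.≤ length xs →
                      Σ (Fin m → A) λ f → Injective _≡_ _≡_ f × (∀ j → P (f j))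
injection-into-list xs xs-unique all-P m≤ =
  (λ j → List.lookup xs (Fin.inject≤ j m≤)) ,
  (λ eq → FinP.inject≤-injective m≤ m≤ _ _ (Unique⇒lookup-injective xs-unique eq)) ,
  (λ j → All.lookup all-P (∈-lookup (Fin.inject≤ j m≤)))

does≡true⇒ : {A : Set} (a? : Dec A) → does a? ≡ true → A
does≡true⇒ (yes a) _ = a

ι*sumOver-frac : ∀ {k} (I : Subset k) (mm : Fin k → ℤ) (n : Fin k → ℕ) (nz : ∀ s → NonZero (n s))
                 {N} (c : Fin k → ℕ) → (∀ s → N ≡ c s ℕ.* n s) →
                 ι (+ N) ℚ.* sumOver I (frac mm n nz) ≡ ι (sumOverℤ I (λ s → mm s ℤ.* + c s))
ι*sumOver-frac {zero}  []          mm n nz {N} c N≡cn = ℚP.*-zeroʳ (ι (+ N))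
ι*sumOver-frac {suc k} (false ∷ I) mm n nz     c N≡cn =
  ι*sumOver-frac I (mm ∘ suc) (n ∘ suc) (nz ∘ suc) (c ∘ suc) (N≡cn ∘ suc)
ι*sumOver-frac {suc k} (true  ∷ I) mm n nz {N} c N≡cn = begin
  ι (+ N) ℚ.* (frac mm n nz zero ℚ.+ sumOver I (frac (mm ∘ suc) (n ∘ suc) (nz ∘ suc)))
    ≡⟨ ℚP.*-distribˡ-+ (ι (+ N)) _ _ ⟩
  ι (+ N) ℚ.* frac mm n nz zero ℚ.+ ι (+ N) ℚ.* sumOver I (frac (mm ∘ suc) (n ∘ suc) (nz ∘ suc))
    ≡⟨ cong₂ ℚ._+_ first-term (ι*sumOver-frac I (mm ∘ suc) (n ∘ suc) (nz ∘ suc) (c ∘ suc) (N≡cn ∘ suc)) ⟩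
  ι (mm zero ℤ.* + c zero) ℚ.+ ι (sumOverℤ I (λ s → mm (suc s) ℤ.* + c (suc s)))
    ≡⟨ ι-homo-+ (mm zero ℤ.* + c zero) _ ⟨
  ι (mm zero ℤ.* + c zero ℤ.+ sumOverℤ I (λ s → mm (suc s) ℤ.* + c (suc s)))
    ∎
  where
  open ≡-Reasoning
  first-term : ι (+ N) ℚ.* frac mm n nz zero ≡ ι (mm zero ℤ.* + c zero)
  first-term = trans (cong (λ x → ι (+ x) ℚ.* frac mm n nz zero) (N≡cn zero))
                     (ι-*-/ (mm zero) (c zero) (n zero) {{nz zero}})

module CommonDenominator {k} (a : Fin k → ℤ) (n : Fin k → ℕ) (nz : ∀ s → NonZero (n s)) (mm : Fin k → ℤ) where

  N : ℕ
  N = product (List.tabulate n)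

  instance
    N≢0 : NonZero N
    N≢0 = product≢0 (AllP.tabulate⁺ nz)

  n∣N : ∀ s → n s ℕD.∣ N
  n∣N s = ∈⇒∣product (∈-tabulate⁺ s)

  c : Fin k → ℕ
  c s = ℕD._∣_.quotient (n∣N s)

  N≡c*n : ∀ s → N ≡ c s ℕ.* n s
  N≡c*n s = ℕD._∣_.equality (n∣N s)

  -- With E s = m_s c_s we have m_s / n_s = E s / N.
  E B : Fin k → ℤ
  E s = mm s ℤ.* + c s
  B s = ℤ.- (E s ℤ.* a s)

  δ : ℕ → Fin k → ℤ
  δ x s = + x ℤ.* E s ℤ.+ B s

  covering : ℕ → Subset k
  covering x = Vec.tabulate (λ s → does (n s ℕD.∣? ℤ.∣ + x ℤ.- a s ∣))

  N∣δ : ∀ x {s} → s ∈ covering x → + N ∣ δ x s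
  N∣δ x {s} s∈ = subst (+ N ∣_) (sym δ≡) (ℤD.∣n⇒∣m*n (mm s) N∣c[x-a])
    where
    n∣x-a : n s ℕD.∣ ℤ.∣ + x ℤ.- a s ∣
    n∣x-a = does≡true⇒ (n s ℕD.∣? ℤ.∣ + x ℤ.- a s ∣)
                       (trans (sym (VecP.lookup∘tabulate _ s)) (VecP.[]=⇒lookup s∈))
    N∣c[x-a] : + N ∣ + c s ℤ.* (+ x ℤ.- a s)
    N∣c[x-a] = subst (_∣ + c s ℤ.* (+ x ℤ.- a s)) (trans (sym (ℤP.pos-* (c s) (n s))) (cong +_ (sym (N≡c*n s))))
                 (ℤD.*-monoʳ-∣ (+ c s) (ℤD.∣ᵤ⇒∣ n∣x-a))
    rearrange : ∀ x m c a → x ℤ.* (m ℤ.* c) ℤ.+ ℤ.- (m ℤ.* c ℤ.* a) ≡ m ℤ.* (c ℤ.* (x ℤ.- a))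
    rearrange = ℤ-solve-∀
    δ≡ : δ x s ≡ mm s ℤ.* (+ c s ℤ.* (+ x ℤ.- a s))
    δ≡ = rearrange (+ x) (mm s) (+ c s) (a s)

  N∣E⇒integral : ∀ I → + N ∣ sumOverℤ I E → IsInt (sumOver I (frac mm n nz))
  N∣E⇒integral I (divides w eq) = w , ι-*-cancelˡ N (begin
    ι (+ N) ℚ.* sumOver I (frac mm n nz)   ≡⟨ ι*sumOver-frac I mm n nz c N≡c*n ⟩
    ι (sumOverℤ I E)                        ≡⟨ cong ι (trans eq (ℤP.*-comm w (+ N))) ⟩
    ι (+ N ℤ.* w)                           ≡⟨ ι-homo-* (+ N) w ⟩
    ι (+ N) ℚ.* ι w                         ∎)
    where open ≡-Reasoning

module AttainedResidues (m k : ℕ) (a : Fin k → ℤ) (n : Fin k → ℕ) (nz : ∀ s → NonZero (n s))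
  (cover : IsCover m a n) (mm : Fin k → ℤ) (μ : Fin k → ℚ)
  (integral⇒integral : ∀ I → IsInt (sumOver I (frac mm n nz)) → IsInt (sumOver I μ))
  (p : ℕ) (p-prime : Prime p)
  (no-multiple : ∀ I → Nonempty I → IsInt (sumOver I (frac mm n nz)) → ¬ InMultiples p (sumOver I μ)) where

  open CommonDenominator a n nz mm
  open PrimeDivisors N
  open Kernel N

  instance
    p≢0 : NonZero p
    p≢0 = prime⇒nonZero p-prime

  attained? : ∀ r → Dec (Attained p (frac mm n nz) μ r)
  attained? r = anySubset? λ I → nonempty? I ×-dec isInt? (sumOver I (frac mm n nz))
                                               ×-dec inMultiples? p (sumOver I μ ℚ.- ι (+ toℕ r))

  attained : List (Fin p)
  attained = filter attained? (allFin p)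

  residues : List ℤ
  residues = map (λ r → + toℕ r) attained

  P : ℚ → ℚ
  P = ∏[t-r] (map ι residues)

  h : ℤ → ℤ
  h = kernel cofactor primeDivisors

  e b : Subset k → ℤ
  e I = sumOverℤ I E
  b I = sumOverℤ I B

  K : Subset k → ℤ
  K I = sumℤ N (λ x → h (+ x ℤ.* e I ℤ.+ b I))

  term : Subset k → ℚ
  term I = ι (K I) ℚ.* P (sumOver I μ)

  K-divisible : ∀ I → + N ∣ e I → K I ≡ + N ℤ.* h (b I)
  K-divisible I N∣e = trans (sumℤ-cong N absorb) (sumℤ-const N (h (b I)))
    where
    absorb : ∀ x → h (+ x ℤ.* e I ℤ.+ b I) ≡ h (b I)
    absorb x = trans (cong h (ℤP.+-comm (+ x ℤ.* e I) (b I)))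
                     (kernel-periodic cofactor primeDivisors (b I) (+ x ℤ.* e I) (ℤD.∣n⇒∣m*n (+ x) N∣e))

  K-nondivisible : ∀ I → ¬ + N ∣ e I → K I ≡ + 0
  K-nondivisible I N∤e =
    let q , q∈ , t , N∣te-w = exists-shift (e I) N∤e
    in  kernel-sum≡0 cofactor q∈ (e I) t N∣te-w (b I)

  h[b⊥]≡1 : h (b ⊥) ≡ + 1
  h[b⊥]≡1 = trans (cong h (sumOverℤ-⊥ B)) (kernel[0]≡1 cofactor primeDivisors cofactors-independent)

  degree-P : DegreeBelow (suc (length attained)) P
  degree-P = subst (λ d → DegreeBelow (suc d) P)
               (trans (ListP.length-map ι residues) (ListP.length-map _ attained))
               (DegreeBelow-∏[t-r] (map ι residues))

  altSum-term≡0 : length attained ℕ.< m → altSum term ≡ 0ℚ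
  altSum-term≡0 few = altSum-ι-sumℤ≡0 N (λ x I → h (+ x ℤ.* e I ℤ.+ b I)) (λ I → P (sumOver I μ)) at-each-x
    where
    at-each-x : ∀ x → altSum (λ I → ι (h (+ x ℤ.* e I ℤ.+ b I)) ℚ.* P (sumOver I μ)) ≡ 0ℚ
    at-each-x x = trans (altSum-cong (λ I → cong₂ (λ u t → ι (h u) ℚ.* P t)
                                             (sym (trans (ℤP.+-identityˡ _) (sumOverℤ-linear I (+ x) E B)))
                                             (sym (ℚP.+-identityˡ (sumOver I μ)))))
                        (altSum-periodic*degreeBelow≡0 (kernel-periodic cofactor primeDivisors)
                          (covering x) (δ x) μ (N∣δ x) {P} (DegreeBelow-mono (ℕP.≤-trans few (cover (+ x))) degree-P)
                          (+ 0) 0ℚ)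

  residue : ℤ → Fin p
  residue z = fromℕ< (ℤDM.n%d<d z (+ p))

  p∣z-residue : ∀ z → + p ∣ z ℤ.- + toℕ (residue z)
  p∣z-residue z = divides (z ℤDM./ + p) (begin
    z ℤ.- + toℕ (residue z)                 ≡⟨ cong (λ r → z ℤ.- + r) (FinP.toℕ-fromℕ< (ℤDM.n%d<d z (+ p))) ⟩
    z ℤ.- + (z ℤDM.% + p)                   ≡⟨ cong (ℤ._- + (z ℤDM.% + p)) (ℤDM.a≡a%n+[a/n]*n z (+ p)) ⟩
    (r ℤ.+ q ℤ.* + p) ℤ.- r                 ≡⟨ cancel r (q ℤ.* + p) ⟩
    q ℤ.* + p                               ∎)
    where
    open ≡-Reasoning
    r = + (z ℤDM.% + p)
    q = z ℤDM./ + p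
    cancel : ∀ r x → (r ℤ.+ x) ℤ.- r ≡ x
    cancel = ℤ-solve-∀

  residue-attained : ∀ I → Nonempty I → + N ∣ e I → ∀ z → sumOver I μ ≡ ι z → residue z ∈ₗ attained
  residue-attained I I≢∅ N∣e z μ≡z = ∈-filter⁺ attained? (∈-allFin (residue z))
    (I , I≢∅ , N∣E⇒integral I N∣e ,
     subst (InMultiples p) (trans (ι-homo-minus z r) (cong (ℚ._- ι r) (sym μ≡z))) (∣⇒InMultiples p (p∣z-residue z)))
    where
    r = + toℕ (residue z)

  term-nondivisible : ∀ I → ¬ + N ∣ e I → InMultiples (N ℕ.* p) (term I)
  term-nondivisible I N∤e =
    subst (InMultiples (N ℕ.* p)) (sym term≡0) (∣⇒InMultiples (N ℕ.* p) (divides (+ 0) refl))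
    where
    term≡0 : term I ≡ 0ℚ
    term≡0 = trans (cong (λ x → ι x ℚ.* P (sumOver I μ)) (K-nondivisible I N∤e)) (ℚP.*-zeroˡ (P (sumOver I μ)))

  term-divisible : ∀ I → Nonempty I → + N ∣ e I → InMultiples (N ℕ.* p) (term I)
  term-divisible I I≢∅ N∣e = subst (InMultiples (N ℕ.* p)) (sym term≡) (∣⇒InMultiples (N ℕ.* p) Np∣)
    where
    z : ℤ
    z = proj₁ (integral⇒integral I (N∣E⇒integral I N∣e))
    μ≡z : sumOver I μ ≡ ι z
    μ≡z = proj₂ (integral⇒integral I (N∣E⇒integral I N∣e))
    Π = ∏[t-r]ℤ residues z
    p∣Π : + p ∣ Π
    p∣Π = ∣∏[t-r]ℤ (∈-map⁺ (λ r → + toℕ r) (residue-attained I I≢∅ N∣e z μ≡z)) (p∣z-residue z)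
    Np∣ : + (N ℕ.* p) ∣ + N ℤ.* (h (b I) ℤ.* Π)
    Np∣ = subst (_∣ + N ℤ.* (h (b I) ℤ.* Π)) (sym (ℤP.pos-* N p))
                (ℤD.*-monoʳ-∣ (+ N) (ℤD.∣n⇒∣m*n (h (b I)) p∣Π))
    term≡ : term I ≡ ι (+ N ℤ.* (h (b I) ℤ.* Π))
    term≡ = begin
      ι (K I) ℚ.* P (sumOver I μ)            ≡⟨ cong₂ (λ x t → ι x ℚ.* P t) (K-divisible I N∣e) μ≡z ⟩
      ι (+ N ℤ.* h (b I)) ℚ.* P (ι z)        ≡⟨ cong (ι (+ N ℤ.* h (b I)) ℚ.*_) (∏[t-r]-ι residues z) ⟩
      ι (+ N ℤ.* h (b I)) ℚ.* ι Π            ≡⟨ ι-homo-* (+ N ℤ.* h (b I)) Π ⟨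
      ι ((+ N ℤ.* h (b I)) ℤ.* Π)            ≡⟨ cong ι (ℤP.*-assoc (+ N) (h (b I)) Π) ⟩
      ι (+ N ℤ.* (h (b I) ℤ.* Π))            ∎
      where open ≡-Reasoning

  term-nonempty : ∀ I → Nonempty I → InMultiples (N ℕ.* p) (term I)
  term-nonempty I I≢∅ = by-cases (+ N ∣? e I)
    where
    by-cases : Dec (+ N ∣ e I) → InMultiples (N ℕ.* p) (term I)
    by-cases (yes N∣e) = term-divisible I I≢∅ N∣e
    by-cases (no  N∤e) = term-nondivisible I N∤e

  P₀ : ℤ
  P₀ = ∏[t-r]ℤ residues (+ 0)

  term-⊥ : term ⊥ ≡ ι (+ N ℤ.* P₀)
  term-⊥ = begin
    ι (K ⊥) ℚ.* P (sumOver ⊥ μ)     ≡⟨ cong₂ (λ x t → ι x ℚ.* P t) K⊥≡N (sumOver-⊥ μ) ⟩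
    ι (+ N) ℚ.* P (ι (+ 0))         ≡⟨ cong (ι (+ N) ℚ.*_) (∏[t-r]-ι residues (+ 0)) ⟩
    ι (+ N) ℚ.* ι P₀                ≡⟨ ι-homo-* (+ N) P₀ ⟨
    ι (+ N ℤ.* P₀)                  ∎
    where
    open ≡-Reasoning
    K⊥≡N : K ⊥ ≡ + N
    K⊥≡N = trans (K-divisible ⊥ (subst (+ N ∣_) (sym (sumOverℤ-⊥ E)) (divides (+ 0) refl)))
                 (trans (cong (+ N ℤ.*_) h[b⊥]≡1) (ℤP.*-identityʳ (+ N)))

  attained-sound : All (Attained p (frac mm n nz) μ) attained
  attained-sound = AllP.all-filter attained? (allFin p)

  attained-unique : Unique attained
  attained-unique = UniqueP.filter⁺ attained? (UniqueP.allFin⁺ p)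

  p∤-attained : ∀ {r} → Attained p (frac mm n nz) μ r → ¬ + p ∣ + 0 ℤ.- + toℕ r
  p∤-attained {r} (I , I≢∅ , integral , μ-r∈pℤ) p∣-r =
    no-multiple I I≢∅ integral (subst (InMultiples p) μ-r≡μ μ-r∈pℤ)
    where
    p∣r : p ℕD.∣ toℕ r
    p∣r = subst (p ℕD.∣_) (trans (cong ℤ.∣_∣ (ℤP.+-identityˡ (ℤ.- + toℕ r))) (ℤP.∣-i∣≡∣i∣ (+ toℕ r)))
                (ℤD.∣⇒∣ᵤ p∣-r)
    r≡0 : toℕ r ≡ 0
    r≡0 = trans (sym (ℕDM.m<n⇒m%n≡m (FinP.toℕ<n r))) (ℕD.n∣m⇒m%n≡0 (toℕ r) p p∣r)
    μ-r≡μ : sumOver I μ ℚ.- ι (+ toℕ r) ≡ sumOver I μ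
    μ-r≡μ = trans (cong (λ x → sumOver I μ ℚ.- ι (+ x)) r≡0) (ℚP.+-identityʳ (sumOver I μ))

  p∤P₀ : ¬ + p ∣ P₀
  p∤P₀ = prime∤∏[t-r]ℤ p-prime {residues} (AllP.map⁺ (All.map (λ {r} → p∤-attained {r}) attained-sound))

  m≤#attained : m ℕ.≤ length attained
  m≤#attained = ℕP.≮⇒≥ λ few →
    p∤P₀ (ℤD.*-cancelˡ-∣ (+ N) (subst (_∣ + N ℤ.* P₀) (ℤP.pos-* N p) (N*p∣N*P₀ few)))
    where
    N*p∣N*P₀ : length attained ℕ.< m → + (N ℕ.* p) ∣ + N ℤ.* P₀
    N*p∣N*P₀ few = InMultiples⇒∣ (subst (InMultiples (N ℕ.* p)) term-⊥
      (InMultiples-altSum⇒⊥ (N ℕ.* p) term term-nonempty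
        (subst (InMultiples (N ℕ.* p)) (sym (altSum-term≡0 few))
               (∣⇒InMultiples (N ℕ.* p) (divides (+ 0) refl)))))

corollary3p1 : (m k : ℕ) (a : Fin k → ℤ) (n : Fin k → ℕ) (nz : ∀ s → NonZero (n s))
    → IsCover m a n
    → (mm : Fin k → ℤ) (μ : Fin k → ℚ)
    → (∀ (I : Subset k) → IsInt (sumOver I (frac mm n nz)) → IsInt (sumOver I μ))
    → (p : ℕ) → Prime p
    → (∀ (I : Subset k) → Nonempty I → IsInt (sumOver I (frac mm n nz)) → ¬ InMultiples p (sumOver I μ))
    → Σ (Fin m → Fin p) λ f → Injective _≡_ _≡_ f × (∀ j → Attained p (frac mm n nz) μ (f j))
corollary3p1 m k a n nz cover mm μ integral⇒integral p p-prime no-multiple =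
  injection-into-list attained attained-unique attained-sound m≤#attained
  where open AttainedResidues m k a n nz cover mm μ integral⇒integral p p-prime no-multiple
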